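{- Suppose $a,b$ are positive integers and $r$, $s$ are nonnegative integers such that $\chi_{\ell}(K_r \vee K_{a,b}) - \chi(K_r \vee K_{a,b}) \leq s$. Then for every integer $l \geq r$, $\chi_{\ell}(K_l \vee K_{a,b}) - \chi(K_l \vee K_{a,b}) \leq s$.
   Context: All graphs are finite and simple. For graphs $G,H$ on disjoint vertex sets, the join $G \vee H$ is the graph consisting of $G$, $H$, and all edges joining a vertex of $G$ to a vertex of $H$; $K_n$ is the complete graph on $n$ vertices, and $K_0 \vee G$ is understood as $G$. $K_{a,b}$ is the complete bipartite graph with partite sets of sizes $a$ and $b$. $\chi$ denotes chromatic number and $\chi_\ell$ list chromatic number. -}

module Defs where

open import Data.Nat using (ℕ; _<_)
open import Data.Fin using (Fin)
open import Data.Sum using (_⊎_; inj₁; inj₂)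
open import Data.Product using (_×_; Σ)
open import Data.Unit using (⊤)
open import Data.Empty using (⊥)
open import Data.List using (List; length)
open import Data.List.Membership.Propositional using (_∈_)
open import Data.List.Relation.Unary.Unique.Propositional using (Unique)
open import Relation.Nullary using (¬_)
open import Relation.Binary.PropositionalEquality using (_≡_; _≢_)

-- A (simple) graph: a vertex type with an adjacency relation.
-- All graphs built below are finite, loopless and symmetric.
record Graph : Set₁ where
  field
    V   : Set
    Adj : V → V → Set
open Graph public

K : ℕ → Graph
K n = record { V = Fin n ; Adj = λ i j → i ≢ j }

KBip : ℕ → ℕ → Graph
KBip a b = record { V = Fin a ⊎ Fin b ; Adj = adj }
  where
  adj : Fin a ⊎ Fin b → Fin a ⊎ Fin b → Set
  adj (inj₁ _) (inj₁ _) = ⊥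
  adj (inj₁ _) (inj₂ _) = ⊤
  adj (inj₂ _) (inj₁ _) = ⊤
  adj (inj₂ _) (inj₂ _) = ⊥

_∨ᴳ_ : Graph → Graph → Graph
G ∨ᴳ H = record { V = V G ⊎ V H ; Adj = adj }
  where
  adj : V G ⊎ V H → V G ⊎ V H → Set
  adj (inj₁ x) (inj₁ y) = Adj G x y
  adj (inj₁ _) (inj₂ _) = ⊤
  adj (inj₂ _) (inj₁ _) = ⊤
  adj (inj₂ x) (inj₂ y) = Adj H x y

Colourable : Graph → ℕ → Set
Colourable G k = Σ (V G → Fin k) λ c → ∀ x y → Adj G x y → c x ≢ c y

IsChromaticNumber : Graph → ℕ → Set
IsChromaticNumber G k = Colourable G k × (∀ j → j < k → ¬ Colourable G j)

IsListAssignment : (G : Graph) → ℕ → (V G → List ℕ) → Set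
IsListAssignment G k L = ∀ x → Unique (L x) × length (L x) ≡ k

ListColourable : (G : Graph) → (V G → List ℕ) → Set
ListColourable G L =
  Σ (V G → ℕ) λ c → (∀ x → c x ∈ L x) × (∀ x y → Adj G x y → c x ≢ c y)

Choosable : Graph → ℕ → Set
Choosable G k = ∀ L → IsListAssignment G k L → ListColourable G L

IsListChromaticNumber : Graph → ℕ → Set
IsListChromaticNumber G k = Choosable G k × (∀ j → j < k → ¬ Choosable G j)

{-# OPTIONS --safe #-}
-- A vertex adjacent to everything raises the choice number by at most one: colour it
-- first from its list and strike that colour from all other lists. Hence
-- χℓ(K_l ∨ K_{a,b}) ≤ χℓ(K_r ∨ K_{a,b}) + (l − r), whereas χ(K_l ∨ K_{a,b}) = l + 2
-- exactly (a 2-colouring of K_{a,b} plus l private colours; a clique of size l + 2),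
-- so the excess χℓ − χ cannot grow with l.
module Submission where

open import Defs
open import Algebra.Properties.CommutativeSemigroup using (x∙yz≈y∙xz)
open import Data.Nat using (ℕ; _≤_; _∸_; zero; suc; _+_; _≟_; s≤s; s≤s⁻¹; z≤n)
import Data.Nat as ℕ
open import Data.Nat.Properties
  using (≮⇒≥; ≤-antisym; ≤-reflexive; m∸n+n≡m; [m+n]∸[m+o]≡n∸o; ∸-monoˡ-≤; m≤n⇒m⊓n≡m;
         +-commutativeSemigroup; module ≤-Reasoning)
open import Data.Fin using (Fin; zero; suc; _<_)
open import Data.Fin.Properties using (pigeonhole; <⇒≢)
open import Data.Sum using (inj₁; inj₂)
open import Data.Product using (_×_; _,_; proj₁; proj₂; ∃-syntax)
open import Data.Unit using (tt)
open import Data.List using (List; []; _∷_; length; take; filter)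
open import Data.List.Properties using (length-take; filter-all; filter-accept; filter-reject)
open import Data.List.Membership.Propositional using (_∈_)
open import Data.List.Membership.Propositional.Properties using (∈-filter⁻)
open import Data.List.Relation.Unary.Any using (here)
open import Data.List.Relation.Unary.AllPairs using ([]; _∷_)
open import Data.List.Relation.Unary.Unique.Propositional using (Unique)
open import Data.List.Relation.Unary.Unique.Propositional.Properties using (take⁺; filter⁺)
import Data.List.Relation.Binary.Sublist.Propositional as Sublist
open import Data.List.Relation.Binary.Sublist.Propositional.Properties using (take-⊆)
open import Function using (_∘_)
open import Relation.Nullary using (¬_; ¬?; yes; no)
open import Relation.Binary.PropositionalEquality using (_≡_; _≢_; refl; sym; trans; cong; subst)

without : ℕ → List ℕ → List ℕ
without c = filter (¬? ∘ (c ≟_))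

length-without : ∀ c {xs} → Unique xs → length xs ≤ suc (length (without c xs))
length-without c {[]}     []               = z≤n
length-without c {x ∷ xs} (x≢xs ∷ xs-uniq) with c ≟ x
... | yes refl = ≤-reflexive (cong (suc ∘ length) (sym without-x))
  where
  without-x : without x (x ∷ xs) ≡ xs
  without-x = trans (filter-reject (¬? ∘ (x ≟_)) (λ x≢x → x≢x refl)) (filter-all (¬? ∘ (x ≟_)) x≢xs)
... | no c≢x = subst (λ ys → suc (length xs) ≤ suc (length ys))
                     (sym (filter-accept (¬? ∘ (c ≟_)) c≢x)) (s≤s (length-without c xs-uniq))

-- When c ∉ xs nothing is filtered out, and the take drops an element instead.
shrinkAvoiding : ℕ → ℕ → List ℕ → List ℕ
shrinkAvoiding c k xs = take k (without c xs)

shrinkAvoiding-unique : ∀ c k {xs} → Unique xs → Unique (shrinkAvoiding c k xs)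
shrinkAvoiding-unique c k xs-uniq = take⁺ k (filter⁺ (¬? ∘ (c ≟_)) xs-uniq)

length-shrinkAvoiding : ∀ c k {xs} → Unique xs → length xs ≡ suc k →
                        length (shrinkAvoiding c k xs) ≡ k
length-shrinkAvoiding c k {xs} xs-uniq len = trans (length-take k _) (m≤n⇒m⊓n≡m k≤filtered)
  where
  k≤filtered : k ≤ length (without c xs)
  k≤filtered = s≤s⁻¹ (subst (_≤ suc (length (without c xs))) len (length-without c xs-uniq))

∈-shrinkAvoiding⁻ : ∀ c k {xs x} → x ∈ shrinkAvoiding c k xs → x ∈ xs × c ≢ x
∈-shrinkAvoiding⁻ c k x∈ = ∈-filter⁻ (¬? ∘ (c ≟_)) (Sublist.lookup (take-⊆ k _) x∈)

∈-of-length-suc : ∀ {k} (xs : List ℕ) → length xs ≡ suc k → ∃[ x ] x ∈ xs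
∈-of-length-suc (x ∷ _) _ = x , here refl

choosable-K-suc : ∀ H {n k} → Choosable (K n ∨ᴳ H) k → Choosable (K (suc n) ∨ᴳ H) (suc k)
choosable-K-suc H {n} {k} choosable L L-is = colour , colour∈L , colour-proper
  where
  old : V (K n ∨ᴳ H) → V (K (suc n) ∨ᴳ H)
  old (inj₁ i) = inj₁ (suc i)
  old (inj₂ h) = inj₂ h

  apex-choice : ∃[ c ] c ∈ L (inj₁ zero)
  apex-choice = ∈-of-length-suc (L (inj₁ zero)) (proj₂ (L-is (inj₁ zero)))

  c : ℕ
  c = proj₁ apex-choice

  L⁻ : V (K n ∨ᴳ H) → List ℕ
  L⁻ x = shrinkAvoiding c k (L (old x))

  L⁻-is : IsListAssignment (K n ∨ᴳ H) k L⁻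
  L⁻-is x = shrinkAvoiding-unique c k uniq , length-shrinkAvoiding c k uniq (proj₂ (L-is (old x)))
    where
    uniq : Unique (L (old x))
    uniq = proj₁ (L-is (old x))

  c⁻ : V (K n ∨ᴳ H) → ℕ
  c⁻ = proj₁ (choosable L⁻ L⁻-is)

  c⁻∈ : ∀ x → c⁻ x ∈ L (old x) × c ≢ c⁻ x
  c⁻∈ x = ∈-shrinkAvoiding⁻ c k (proj₁ (proj₂ (choosable L⁻ L⁻-is)) x)

  c⁻-proper : ∀ x y → Adj (K n ∨ᴳ H) x y → c⁻ x ≢ c⁻ y
  c⁻-proper = proj₂ (proj₂ (choosable L⁻ L⁻-is))

  colour : V (K (suc n) ∨ᴳ H) → ℕ
  colour (inj₁ zero)    = c
  colour (inj₁ (suc i)) = c⁻ (inj₁ i)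
  colour (inj₂ h)       = c⁻ (inj₂ h)

  colour∈L : ∀ x → colour x ∈ L x
  colour∈L (inj₁ zero)    = proj₂ apex-choice
  colour∈L (inj₁ (suc i)) = proj₁ (c⁻∈ (inj₁ i))
  colour∈L (inj₂ h)       = proj₁ (c⁻∈ (inj₂ h))

  c≢old : ∀ x → c ≢ colour (old x)
  c≢old (inj₁ i) = proj₂ (c⁻∈ (inj₁ i))
  c≢old (inj₂ h) = proj₂ (c⁻∈ (inj₂ h))

  colour-proper : ∀ x y → Adj (K (suc n) ∨ᴳ H) x y → colour x ≢ colour y
  colour-proper (inj₁ zero)    (inj₁ zero)    x≢x = λ _ → x≢x refl
  colour-proper (inj₁ zero)    (inj₁ (suc j)) _   = c≢old (inj₁ j)
  colour-proper (inj₁ zero)    (inj₂ h)       _   = c≢old (inj₂ h)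
  colour-proper (inj₁ (suc i)) (inj₁ zero)    _   = c≢old (inj₁ i) ∘ sym
  colour-proper (inj₂ h)       (inj₁ zero)    _   = c≢old (inj₂ h) ∘ sym
  colour-proper (inj₁ (suc i)) (inj₁ (suc j)) i≢j = c⁻-proper (inj₁ i) (inj₁ j) (i≢j ∘ cong suc)
  colour-proper (inj₁ (suc i)) (inj₂ h)       _   = c⁻-proper (inj₁ i) (inj₂ h) tt
  colour-proper (inj₂ h)       (inj₁ (suc j)) _   = c⁻-proper (inj₂ h) (inj₁ j) tt
  colour-proper (inj₂ h)       (inj₂ h′)      adj = c⁻-proper (inj₂ h) (inj₂ h′) adj

choosable-K-+ : ∀ H {n k} d → Choosable (K n ∨ᴳ H) k → Choosable (K (d + n) ∨ᴳ H) (d + k)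
choosable-K-+ H zero    choosable = choosable
choosable-K-+ H (suc d) choosable = choosable-K-suc H (choosable-K-+ H d choosable)

clique⇒¬colourable : ∀ {G m j} (f : Fin m → V G) → (∀ {i i′} → i < i′ → Adj G (f i) (f i′)) →
                     j ℕ.< m → ¬ Colourable G j
clique⇒¬colourable f clique j<m (c , proper)
  with i , i′ , i<i′ , same ← pigeonhole j<m (c ∘ f) = proper _ _ (clique i<i′) same

K∨KBip-colourable : ∀ {a b} l → Colourable (K l ∨ᴳ KBip a b) (2 + l)
K∨KBip-colourable l = colour , proper
  where
  colour : V (K l ∨ᴳ KBip _ _) → Fin (2 + l)
  colour (inj₁ i)        = suc (suc i)
  colour (inj₂ (inj₁ _)) = zero
  colour (inj₂ (inj₂ _)) = suc zero

  proper : ∀ x y → Adj (K l ∨ᴳ KBip _ _) x y → colour x ≢ colour y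
  proper (inj₁ i)        (inj₁ j)        i≢j refl = i≢j refl
  proper (inj₁ _)        (inj₂ (inj₁ _)) _   ()
  proper (inj₁ _)        (inj₂ (inj₂ _)) _   ()
  proper (inj₂ (inj₁ _)) (inj₁ _)        _   ()
  proper (inj₂ (inj₂ _)) (inj₁ _)        _   ()
  proper (inj₂ (inj₁ _)) (inj₂ (inj₂ _)) _   ()
  proper (inj₂ (inj₂ _)) (inj₂ (inj₁ _)) _   ()

K∨KBip-clique : ∀ {a b} l → Fin (2 + l) → V (K l ∨ᴳ KBip (suc a) (suc b))
K∨KBip-clique l zero          = inj₂ (inj₁ zero)
K∨KBip-clique l (suc zero)    = inj₂ (inj₂ zero)
K∨KBip-clique l (suc (suc i)) = inj₁ i

K∨KBip-clique-adj : ∀ {a b} l {i i′} → i < i′ →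
                    Adj (K l ∨ᴳ KBip (suc a) (suc b)) (K∨KBip-clique l i) (K∨KBip-clique l i′)
K∨KBip-clique-adj l {zero}        {suc zero}     _                 = tt
K∨KBip-clique-adj l {zero}        {suc (suc _)}  _                 = tt
K∨KBip-clique-adj l {suc zero}    {suc zero}     (s≤s ())
K∨KBip-clique-adj l {suc zero}    {suc (suc _)}  _                 = tt
K∨KBip-clique-adj l {suc (suc _)} {suc (suc _)}  (s≤s (s≤s i<i′)) = <⇒≢ i<i′

K∨KBip-chromatic : ∀ {a b} l → IsChromaticNumber (K l ∨ᴳ KBip (suc a) (suc b)) (2 + l)
K∨KBip-chromatic l =
  K∨KBip-colourable l , λ _ j<2+l → clique⇒¬colourable (K∨KBip-clique l) (K∨KBip-clique-adj l) j<2+l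

IsChromaticNumber-unique : ∀ {G m n} → IsChromaticNumber G m → IsChromaticNumber G n → m ≡ n
IsChromaticNumber-unique (m-colourable , below-m) (n-colourable , below-n) = ≤-antisym
  (≮⇒≥ λ n<m → below-m _ n<m n-colourable)
  (≮⇒≥ λ m<n → below-n _ m<n m-colourable)

IsListChromaticNumber⇒≤ : ∀ {G m k} → IsListChromaticNumber G m → Choosable G k → m ≤ k
IsListChromaticNumber⇒≤ (_ , below-m) k-choosable = ≮⇒≥ λ k<m → below-m _ k<m k-choosable

lemma16 : (a b r s : ℕ) → 1 ≤ a → 1 ≤ b →
          (χr χℓr : ℕ) →
          IsChromaticNumber (K r ∨ᴳ KBip a b) χr →
          IsListChromaticNumber (K r ∨ᴳ KBip a b) χℓr →
          χℓr ∸ χr ≤ s →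
          (l : ℕ) → r ≤ l →
          (χl χℓl : ℕ) →
          IsChromaticNumber (K l ∨ᴳ KBip a b) χl →
          IsListChromaticNumber (K l ∨ᴳ KBip a b) χℓl →
          χℓl ∸ χl ≤ s
lemma16 (suc a) (suc b) r s _ _ χr χℓr χr-is (r-choosable , _) excess≤s l r≤l χl χℓl χl-is χℓl-is =
  begin
    χℓl ∸ χl                  ≡⟨ cong (χℓl ∸_) (IsChromaticNumber-unique χl-is (K∨KBip-chromatic l)) ⟩
    χℓl ∸ (2 + l)             ≤⟨ ∸-monoˡ-≤ (2 + l) χℓl≤d+χℓr ⟩
    (d + χℓr) ∸ (2 + l)       ≡⟨ cong ((d + χℓr) ∸_) 2+l≡d+[2+r] ⟩
    (d + χℓr) ∸ (d + (2 + r)) ≡⟨ [m+n]∸[m+o]≡n∸o d χℓr (2 + r) ⟩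
    χℓr ∸ (2 + r)             ≡⟨ cong (χℓr ∸_) (IsChromaticNumber-unique (K∨KBip-chromatic r) χr-is) ⟩
    χℓr ∸ χr                  ≤⟨ excess≤s ⟩
    s                         ∎
  where
  open ≤-Reasoning
  d : ℕ
  d = l ∸ r

  d+r≡l : d + r ≡ l
  d+r≡l = m∸n+n≡m r≤l

  2+l≡d+[2+r] : 2 + l ≡ d + (2 + r)
  2+l≡d+[2+r] = trans (cong (2 +_) (sym d+r≡l)) (x∙yz≈y∙xz +-commutativeSemigroup 2 d r)

  χℓl≤d+χℓr : χℓl ≤ d + χℓr
  χℓl≤d+χℓr = IsListChromaticNumber⇒≤ χℓl-is
    (subst (λ m → Choosable (K m ∨ᴳ KBip _ _) (d + χℓr)) d+r≡l (choosable-K-+ _ d r-choosable))
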